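{- For every integer $n\geq 4$, $\mathrm{cat}(W_n)=n+1$, where $W_n$ is the wheel on $n$ vertices: $n-1$ vertices $v_1,\dots,v_{n-1}$ forming a cycle and one further vertex $v_0$ adjacent to all of $v_1,\dots,v_{n-1}$.
   Context: Cat Herding is a two-player game on a finite simple graph $G$ between a cat and a herder. First the cat places its token on a starting vertex. Then the players alternate, the herder moving first: on the herder's turn it deletes one edge of the current graph (a "cut"); on the cat's turn the cat must move its token along a path of the current graph to a different vertex. The game ends when the cat's current vertex has no incident edges. The score is the total number of edges deleted; the herder minimizes and the cat maximizes it. For $v\in V(G)$, $\mathrm{cat}(G,v)$ is the optimal-play score when the cat starts at $v$, and $\mathrm{cat}(G)=\max_{v\in V(G)}\mathrm{cat}(G,v)$. -}

module Defs where

open import Data.Nat using (ℕ; zero; suc; _∸_)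
open import Data.Fin using (Fin; toℕ)
open import Data.Product using (Σ; ∃; _×_; _,_)
open import Data.Sum using (_⊎_)
open import Relation.Nullary using (¬_)
open import Relation.Binary.PropositionalEquality using (_≡_; _≢_)
open import Relation.Binary.Construct.Closure.ReflexiveTransitive using (Star)

-- A (finite) graph on vertex set Fin m, given by its adjacency relation.
-- (All graphs arising in the game are symmetric and irreflexive when the
-- starting graph is; the starting graph here is the wheel.)
Graph : ℕ → Set₁
Graph m = Fin m → Fin m → Set

deleteEdge : ∀ {m} → Graph m → Fin m → Fin m → Graph m
deleteEdge E a b x y = E x y × ¬ ((x ≡ a × y ≡ b) ⊎ (x ≡ b × y ≡ a))

Isolated : ∀ {m} → Graph m → Fin m → Set
Isolated E v = ∀ w → ¬ E v w

Reach : ∀ {m} → Graph m → Fin m → Fin m → Set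
Reach E = Star E

-- Positions are "herder to move, cat at v, current graph E"; scores count
-- the number of edges deleted from that position on.

-- HerderWins k E v : the herder can ensure at most k further edges are deleted.
data HerderWins {m : ℕ} : ℕ → Graph m → Fin m → Set₁ where
  over : ∀ {k E v} → Isolated E v → HerderWins k E v
  cut  : ∀ {k E v} (a b : Fin m) → E a b →
         (∀ w → w ≢ v → Reach (deleteEdge E a b) v w →
                HerderWins k (deleteEdge E a b) w) →
         HerderWins (suc k) E v

-- CatWins k E v : the cat can ensure at least k further edges are deleted.
data CatWins {m : ℕ} : ℕ → Graph m → Fin m → Set₁ where
  triv : ∀ {E v} → CatWins zero E v
  step : ∀ {k E v} → (∃ λ w → E v w) →
         (∀ a b → E a b →
            (k ≡ zero) ⊎
            (Σ (Fin m) λ w → w ≢ v × Reach (deleteEdge E a b) v w ×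
                             CatWins k (deleteEdge E a b) w)) →
         CatWins (suc k) E v

CatAt : ∀ {m} → Graph m → Fin m → ℕ → Set₁
CatAt G v k = HerderWins k G v × CatWins k G v

CatNumber : ∀ {m} → Graph m → ℕ → Set₁
CatNumber {m} G k =
  (Σ (Fin m) λ v → CatAt G v k) ×
  (∀ (v : Fin m) → Σ ℕ λ j → CatAt G v j × j Data.Nat.≤ k)

-- The wheel W_n on vertex set Fin n: vertex 0 is the hub v_0, adjacent to all
-- others; vertices 1,…,n-1 form the cycle v_1 v_2 … v_{n-1} v_1.
WheelAdj : (n : ℕ) → Graph n
WheelAdj n i j =
  (toℕ i ≡ 0 × toℕ j ≢ 0) ⊎
  (toℕ j ≡ 0 × toℕ i ≢ 0) ⊎
  (toℕ i ≢ 0 × toℕ j ≡ suc (toℕ i)) ⊎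
  (toℕ j ≢ 0 × toℕ i ≡ suc (toℕ j)) ⊎
  (toℕ i ≡ 1 × toℕ j ≡ n ∸ 1) ⊎
  (toℕ j ≡ 1 × toℕ i ≡ n ∸ 1)

-- Write m = n - 1 for the number of rim vertices, so that W_n has 2m edges.
--
-- Herder: cut the m rim edges first. What is left is a star, where the cat scores at most
-- two more cuts: one if it sits on a leaf, two if it sits at the centre.
--
-- Cat: stay on rim vertices that carry a spoke and share their rim arc (a maximal path of
-- surviving rim edges) with a second spoked vertex. After any single cut such a vertex still
-- reaches the hub, either by its own spoke or along the arc and the other spoke. If every arc
-- carried at most one spoke, at most m edges (m + 1 if the rim is a whole cycle) could be left,
-- so while at least m + 2 edges remain the cat can walk through the hub to a new such vertex
-- after each cut. At m + 1 edges it walks instead to the middle of a trail of four distinct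
-- edges, which is worth three more cuts. From 2m edges this gives (m - 1) + 3 = m + 2 cuts.
module Submission where

open import Defs
open import Data.Bool using (Bool; true; false; if_then_else_) renaming (_≟_ to _≟ᵇ_)
open import Data.Bool.Properties using (¬-not)
open import Data.Empty using (⊥-elim)
open import Data.Fin using (Fin; toℕ; fromℕ<)
open import Data.Fin.Properties using (toℕ-injective; toℕ-fromℕ<; toℕ<n)
open import Data.List using (_∷_; [])
open import Data.List.Relation.Unary.All using (_∷_; [])
open import Data.List.Relation.Unary.AllPairs using (_∷_; [])
open import Data.List.Relation.Unary.Unique.Propositional using (Unique)
open import Data.Nat
open import Data.Nat.Properties
open import Algebra.Properties.CommutativeSemigroup +-commutativeSemigroup using (interchange; x∙yz≈y∙xz)
open import Data.Product using (Σ; ∃; _×_; _,_; proj₁; proj₂; swap)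
open import Data.Sum using (_⊎_; inj₁; inj₂)
open import Data.Sum.Properties using (≡-dec; inj₁-injective; inj₂-injective)
open import Function using (_∘_)
open import Relation.Binary.Core using (_⇒_; _⇔_)
open import Relation.Binary.Definitions using (DecidableEquality)
open import Relation.Binary.PropositionalEquality
open import Relation.Binary.Construct.Closure.ReflexiveTransitive as Star using (Star; ε; _◅_; _◅◅_)
open import Relation.Nullary using (¬_; Dec; yes; no; does)
open import Relation.Nullary.Decidable using (map′; _×-dec_; ¬?; dec-true; dec-false)

deleteEdge-mono : ∀ {n} {E F : Graph n} {a b} → E ⇒ F → deleteEdge E a b ⇒ deleteEdge F a b
deleteEdge-mono E⇒F {x} {y} (xy , xy≢ab) = E⇒F {x} {y} xy , xy≢ab

deleteEdge-cong : ∀ {n} {E F : Graph n} {a b} → E ⇔ F → deleteEdge E a b ⇔ deleteEdge F a b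
deleteEdge-cong {E = E} {F} (E⇒F , F⇒E) =
  deleteEdge-mono {E = E} {F} E⇒F , deleteEdge-mono {E = F} {E} F⇒E

catWins-cong : ∀ {n k} {E F : Graph n} {v} → E ⇔ F → CatWins k E v → CatWins k F v
catWins-cong E⇔F triv = triv
catWins-cong {E = E} {F} {v} E⇔F@(E⇒F , F⇒E) (step (w , vw) respond) =
  step (w , E⇒F {v} {w} vw) λ a b ab → Data.Sum.map₂ (transport a b) (respond a b (F⇒E {a} {b} ab))
  where
  transport : ∀ {k} a b →
    (Σ (Fin _) λ w → w ≢ v × Reach (deleteEdge E a b) v w × CatWins k (deleteEdge E a b) w) →
    (Σ (Fin _) λ w → w ≢ v × Reach (deleteEdge F a b) v w × CatWins k (deleteEdge F a b) w)
  transport a b (w , w≢v , path , wins) =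
    w , w≢v , Star.map (deleteEdge-mono {E = E} {F} E⇒F) path , catWins-cong (deleteEdge-cong E⇔F) wins

herderWins-cong : ∀ {n k} {E F : Graph n} {v} → E ⇔ F → HerderWins k E v → HerderWins k F v
herderWins-cong {v = v} (_ , F⇒E) (over isolated) = over λ w vw → isolated w (F⇒E {v} {w} vw)
herderWins-cong {E = E} {F} E⇔F@(E⇒F , F⇒E) (cut a b ab next) =
  cut a b (E⇒F {a} {b} ab) λ w w≢v path →
    herderWins-cong (deleteEdge-cong E⇔F) (next w w≢v (Star.map (deleteEdge-mono {E = F} {E} F⇒E) path))

herderWins-suc : ∀ {n k} {E : Graph n} {v} → HerderWins k E v → HerderWins (suc k) E v
herderWins-suc (over isolated)   = over isolated
herderWins-suc (cut a b ab next) = cut a b ab λ w w≢v path → herderWins-suc (next w w≢v path)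

herderWins-pendant : ∀ {n} {E : Graph n} {v h} →
                     (∀ {y} → E v y → y ≡ h) → Dec (E v h) → HerderWins 1 E v
herderWins-pendant {E = E} {v} only-h (no ¬vh) = over λ y vy → ¬vh (subst (E v) (only-h vy) vy)
herderWins-pendant {E = E} {v} {h} only-h (yes vh) = cut v h vh stuck
  where
  stuck : ∀ w → w ≢ v → Reach (deleteEdge E v h) v w → HerderWins 0 (deleteEdge E v h) w
  stuck w w≢v ε                  = ⊥-elim (w≢v refl)
  stuck w w≢v ((vy , vy≢vh) ◅ _) = ⊥-elim (vy≢vh (inj₁ (refl , only-h vy)))

InRange : ℕ → ℕ → Set
InRange k i = 1 ≤ i × i ≤ k

inRange-top : ∀ {k} → InRange (suc k) (suc k)
inRange-top = s≤s z≤n , ≤-refl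

inRange-suc : ∀ {k i} → InRange k i → InRange (suc k) i
inRange-suc (1≤i , i≤k) = 1≤i , m≤n⇒m≤1+n i≤k

inRange-pred : ∀ {k i} → InRange (suc k) i → i ≢ suc k → InRange k i
inRange-pred (1≤i , i≤1+k) i≢1+k = 1≤i , s≤s⁻¹ (≤∧≢⇒< i≤1+k i≢1+k)

search : ∀ {P : ℕ → Set} → (∀ i → Dec (P i)) → ∀ k → Dec (∃ λ i → InRange k i × P i)
search {P} P? k = map′ inward outward (anyUpTo? (λ i → (1 ≤? i) ×-dec P? i) (suc k))
  where
  inward : (∃ λ i → i < suc k × 1 ≤ i × P i) → ∃ λ i → InRange k i × P i
  inward (i , i<1+k , 1≤i , Pi) = i , (1≤i , s≤s⁻¹ i<1+k) , Pi
  outward : (∃ λ i → InRange k i × P i) → ∃ λ i → i < suc k × 1 ≤ i × P i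
  outward (i , (1≤i , i≤k) , Pi) = i , s≤s i≤k , 1≤i , Pi

sumTo : (ℕ → ℕ) → ℕ → ℕ
sumTo f zero    = 0
sumTo f (suc k) = f (suc k) + sumTo f k

module _ {f g : ℕ → ℕ} where

  sumTo-cong : ∀ k → (∀ i → InRange k i → f i ≡ g i) → sumTo f k ≡ sumTo g k
  sumTo-cong zero    f≗g = refl
  sumTo-cong (suc k) f≗g =
    cong₂ _+_ (f≗g (suc k) inRange-top) (sumTo-cong k λ i → f≗g i ∘ inRange-suc)

  sumTo-mono : ∀ k → (∀ i → InRange k i → f i ≤ g i) → sumTo f k ≤ sumTo g k
  sumTo-mono zero    f≤g = z≤n
  sumTo-mono (suc k) f≤g =
    +-mono-≤ (f≤g (suc k) inRange-top) (sumTo-mono k λ i → f≤g i ∘ inRange-suc)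

  sumTo-+ : ∀ k → sumTo (λ i → f i + g i) k ≡ sumTo f k + sumTo g k
  sumTo-+ zero    = refl
  sumTo-+ (suc k) = trans (cong (f (suc k) + g (suc k) +_) (sumTo-+ k)) (interchange (f (suc k)) _ _ _)

  sumTo-update : ∀ k {j} → InRange k j → (∀ i → i ≢ j → f i ≡ g i) → f j ≡ suc (g j) →
                 sumTo f k ≡ suc (sumTo g k)
  sumTo-update zero    (1≤j , j≤0) f≗g fj = ⊥-elim (<⇒≱ 1≤j j≤0)
  sumTo-update (suc k) {j} j∈ f≗g fj with suc k ≟ j
  ... | yes refl = cong₂ _+_ fj (sumTo-cong k λ i i∈ → f≗g i (<⇒≢ (s≤s (proj₂ i∈))))
  ... | no  k≢j  =
    trans (cong₂ _+_ (f≗g (suc k) k≢j) (sumTo-update k (inRange-pred j∈ (k≢j ∘ sym)) f≗g fj))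
          (+-suc (g (suc k)) (sumTo g k))

sumTo-const : ∀ k → sumTo (λ _ → 1) k ≡ k
sumTo-const zero    = refl
sumTo-const (suc k) = cong suc (sumTo-const k)

bit : Bool → ℕ
bit true  = 1
bit false = 0

bit≤1 : ∀ b → bit b ≤ 1
bit≤1 true  = ≤-refl
bit≤1 false = z≤n

count : (ℕ → Bool) → ℕ → ℕ
count h = sumTo (bit ∘ h)

count-≤ : ∀ h k → count h k ≤ k
count-≤ h k = subst (count h k ≤_) (sumTo-const k) (sumTo-mono k λ i _ → bit≤1 (h i))

count-all : ∀ {h} k → (∀ i → InRange k i → h i ≡ true) → count h k ≡ k
count-all k all = trans (sumTo-cong k λ i i∈ → cong bit (all i i∈)) (sumTo-const k)

count-none : ∀ {h} k → (∀ i → InRange k i → h i ≡ false) → count h k ≡ 0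
count-none zero    none = refl
count-none (suc k) none rewrite none (suc k) inRange-top = count-none k λ i → none i ∘ inRange-suc

count-remove : ∀ {h h′} k {j} → InRange k j → (∀ i → i ≢ j → h i ≡ h′ i) → h j ≡ true → h′ j ≡ false →
               count h k ≡ suc (count h′ k)
count-remove k j∈ h≗h′ hj h′j =
  sumTo-update k j∈ (λ i i≢j → cong bit (h≗h′ i i≢j)) (trans (cong bit hj) (cong (suc ∘ bit) (sym h′j)))

pointAt : ℕ → ℕ → Bool
pointAt j i = does (i ≟ j)

pointAt-self : ∀ j → pointAt j j ≡ true
pointAt-self j = dec-true (j ≟ j) refl

pointAt-other : ∀ {i j} → i ≢ j → pointAt j i ≡ false
pointAt-other {i} {j} = dec-false (i ≟ j)

count-pointAt : ∀ k {j} → InRange k j → count (pointAt j) k ≡ 1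
count-pointAt k {j} j∈ =
  trans (count-remove {h′ = λ _ → false} k j∈ (λ i → pointAt-other) (pointAt-self j) refl)
        (cong suc (count-none k λ _ _ → refl))

count-≤2 : ∀ {h} k {a b} → InRange k a → InRange k b →
           (∀ i → InRange k i → h i ≡ true → i ≡ a ⊎ i ≡ b) → count h k ≤ 2
count-≤2 {h} k {a} {b} a∈ b∈ only-ab =
  ≤-trans (sumTo-mono k covered)
          (≤-reflexive (trans (sumTo-+ k) (cong₂ _+_ (count-pointAt k a∈) (count-pointAt k b∈))))
  where
  covered : ∀ i → InRange k i → bit (h i) ≤ bit (pointAt a i) + bit (pointAt b i)
  covered i i∈ with h i in hi
  ... | false = z≤n
  ... | true with only-ab i i∈ hi
  ...   | inj₁ refl rewrite pointAt-self a = s≤s z≤n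
  ...   | inj₂ refl rewrite pointAt-self b = m≤n+m 1 (bit (pointAt a b))

count-+2 : ∀ {h} k {a b} → InRange k a → InRange k b → a ≢ b → h a ≡ false → h b ≡ false →
           2 + count h k ≤ k
count-+2 {h} k {a} {b} a∈ b∈ a≢b ha hb =
  subst₂ _≤_ (trans (sumTo-+ k) (cong (_+ count h k) two)) (sumTo-const k) (sumTo-mono k disjoint)
  where
  two : sumTo (λ i → bit (pointAt a i) + bit (pointAt b i)) k ≡ 2
  two = trans (sumTo-+ k) (cong₂ _+_ (count-pointAt k a∈) (count-pointAt k b∈))
  disjoint : ∀ i → InRange k i → bit (pointAt a i) + bit (pointAt b i) + bit (h i) ≤ 1
  disjoint i _ with i ≟ a | i ≟ b
  ... | yes refl | yes refl = ⊥-elim (a≢b refl)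
  ... | yes refl | no i≢b   rewrite pointAt-self a | pointAt-other i≢b | ha = ≤-refl
  ... | no i≢a   | yes refl rewrite pointAt-other i≢a | pointAt-self b | hb = ≤-refl
  ... | no i≢a   | no i≢b   rewrite pointAt-other i≢a | pointAt-other i≢b = bit≤1 (h i)

module EdgeLabelled {Label : Set} (_≟ₗ_ : DecidableEquality Label)
                    (Valid : Label → Set) (source target : Label → ℕ) where

  Joins : Label → ℕ → ℕ → Set
  Joins e x y = Valid e × (source e ≡ x × target e ≡ y ⊎ source e ≡ y × target e ≡ x)

  joins-sym : ∀ {e x y} → Joins e x y → Joins e y x
  joins-sym (valid , ends) = valid , Data.Sum.swap ends

  joins-ends : ∀ {e x y x′ y′} → Joins e x y → Joins e x′ y′ →
               (x ≡ x′ × y ≡ y′) ⊎ (x ≡ y′ × y ≡ x′)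
  joins-ends (_ , inj₁ (refl , refl)) (_ , inj₁ (refl , refl)) = inj₁ (refl , refl)
  joins-ends (_ , inj₁ (refl , refl)) (_ , inj₂ (refl , refl)) = inj₂ (refl , refl)
  joins-ends (_ , inj₂ (refl , refl)) (_ , inj₁ (refl , refl)) = inj₂ (refl , refl)
  joins-ends (_ , inj₂ (refl , refl)) (_ , inj₂ (refl , refl)) = inj₁ (refl , refl)

  EdgeSet : Set
  EdgeSet = Label → Bool

  record Link (σ : EdgeSet) (x y : ℕ) : Set where
    constructor link
    field
      label   : Label
      present : σ label ≡ true
      joins   : Joins label x y

  open Link public using (label)

  flip : ∀ {σ x y} → Link σ x y → Link σ y x
  flip (link e present joins) = link e present (joins-sym joins)

  remove : EdgeSet → Label → EdgeSet
  remove σ e f = if does (f ≟ₗ e) then false else σ f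

  remove-removed : ∀ σ e → remove σ e e ≡ false
  remove-removed σ e rewrite dec-true (e ≟ₗ e) refl = refl

  remove-kept : ∀ {σ e f} → f ≢ e → remove σ e f ≡ σ f
  remove-kept {σ} {e} {f} f≢e rewrite dec-false (f ≟ₗ e) f≢e = refl

  remove-true : ∀ {σ e f} → remove σ e f ≡ true → f ≢ e × σ f ≡ true
  remove-true {σ} {e} {f} kept with f ≟ₗ e
  remove-true ()   | yes refl
  remove-true kept | no f≢e = f≢e , kept

  keep : ∀ {σ e x y} (l : Link σ x y) → label l ≢ e → Link (remove σ e) x y
  keep {σ} (link f present joins) f≢e = link f (trans (remove-kept {σ} f≢e) present) joins

  -- `simple` says that an edge is determined by its endpoints, so the herder's cut of {a, b}
  -- removes exactly one label (graph-remove) and the game can be played on edge sets.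
  module Game (n : ℕ)
              (loopless : ∀ {e} → Valid e → source e ≢ target e)
              (source<n : ∀ {e} → Valid e → source e < n)
              (target<n : ∀ {e} → Valid e → target e < n)
              (simple : ∀ {e f x y} → Joins e x y → Joins f x y → e ≡ f) where

    joins-irrefl : ∀ {e x} → ¬ Joins e x x
    joins-irrefl (valid , inj₁ (s≡x , t≡x)) = loopless valid (trans s≡x (sym t≡x))
    joins-irrefl (valid , inj₂ (s≡x , t≡x)) = loopless valid (trans s≡x (sym t≡x))

    joins-< : ∀ {e x y} → Joins e x y → y < n
    joins-< (valid , inj₁ (_ , refl)) = target<n valid
    joins-< (valid , inj₂ (refl , _)) = source<n valid

    graph : EdgeSet → Graph n
    graph σ x y = Link σ (toℕ x) (toℕ y)

    graph-remove : ∀ {σ e} {a b : Fin n} → σ e ≡ true → Joins e (toℕ a) (toℕ b) →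
                   deleteEdge (graph σ) a b ⇔ graph (remove σ e)
    graph-remove {σ} {e} {a} {b} present ab = to , from
      where
      to : ∀ {x y} → deleteEdge (graph σ) a b x y → graph (remove σ e) x y
      to (link f present′ xy , xy≢ab) with f ≟ₗ e
      ... | no f≢e   = keep (link f present′ xy) f≢e
      ... | yes refl with joins-ends xy ab
      ...   | inj₁ (x≡a , y≡b) = ⊥-elim (xy≢ab (inj₁ (toℕ-injective x≡a , toℕ-injective y≡b)))
      ...   | inj₂ (x≡b , y≡a) = ⊥-elim (xy≢ab (inj₂ (toℕ-injective x≡b , toℕ-injective y≡a)))
      from : ∀ {x y} → graph (remove σ e) x y → deleteEdge (graph σ) a b x y
      from {x} {y} (link f kept xy) = link f (proj₂ (remove-true {σ} kept)) xy , xy≢ab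
        where
        xy≢ab : ¬ ((x ≡ a × y ≡ b) ⊎ (x ≡ b × y ≡ a))
        xy≢ab (inj₁ (refl , refl)) = proj₁ (remove-true {σ} kept) (simple xy ab)
        xy≢ab (inj₂ (refl , refl)) = proj₁ (remove-true {σ} kept) (simple (joins-sym xy) ab)

    neighbour : ∀ {σ} {v : Fin n} {y} → Link σ (toℕ v) y → Σ (Fin n) λ w → toℕ w ≡ y × graph σ v w
    neighbour {σ} {v} l@(link _ _ joins) =
      fromℕ< (joins-< joins) , toℕ-fromℕ< _ , subst (Link σ (toℕ v)) (sym (toℕ-fromℕ< _)) l

    walk⇒reach : ∀ {σ x t} → Star (Link σ) x t → ∀ {v : Fin n} → toℕ v ≡ x →
                 Σ (Fin n) λ w → toℕ w ≡ t × Reach (graph σ) v w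
    walk⇒reach ε          refl = _ , refl , ε
    walk⇒reach (l ◅ walk) refl with neighbour l
    ... | u , u≡y , vu with walk⇒reach walk u≡y
    ...   | w , w≡t , uw = w , w≡t , vu ◅ uw

    Move : ∀ {ℓ} → EdgeSet → ℕ → (ℕ → Set ℓ) → Set ℓ
    Move σ x P = Σ ℕ λ t → t ≢ x × Star (Link σ) x t × P t

    Move-map : ∀ {ℓ ℓ′ σ x} {P : ℕ → Set ℓ} {Q : ℕ → Set ℓ′} →
               (∀ {t} → P t → Q t) → Move σ x P → Move σ x Q
    Move-map P⇒Q (t , t≢x , walk , Pt) = t , t≢x , walk , P⇒Q Pt

    moveAlong : ∀ {ℓ σ x y} {P : ℕ → Set ℓ} → Link σ x y → P y → Move σ x P
    moveAlong l@(link _ _ joins) Py =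
      _ , (λ y≡x → joins-irrefl (subst (Joins _ _) y≡x joins)) , l ◅ ε , Py

    CatWinsAt : ℕ → EdgeSet → ℕ → Set₁
    CatWinsAt k σ t = ∀ (w : Fin n) → toℕ w ≡ t → CatWins k (graph σ) w

    catWins-step : ∀ {k σ} {v : Fin n} {y} → Link σ (toℕ v) y →
                   (∀ e → σ e ≡ true → Valid e → Move (remove σ e) (toℕ v) (CatWinsAt k (remove σ e))) →
                   CatWins (suc k) (graph σ) v
    catWins-step {k} {σ} {v} l reply with neighbour l
    ... | w , _ , vw = step (w , vw) respond
      where
      respond : ∀ a b → graph σ a b → (k ≡ 0) ⊎
                (Σ (Fin n) λ w → w ≢ v × Reach (deleteEdge (graph σ) a b) v w ×
                                 CatWins k (deleteEdge (graph σ) a b) w)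
      respond a b (link e present ab) with reply e present (proj₁ ab)
      ... | t , t≢v , walk , wins with walk⇒reach walk refl
      ...   | w , refl , vw = inj₂ (w , (λ w≡v → t≢v (cong toℕ w≡v)) ,
                                    Star.map (proj₂ (graph-remove present ab)) vw ,
                                    catWins-cong (swap (graph-remove present ab)) (wins w refl))

    herderWins-cut : ∀ {k σ e} {v : Fin n} → σ e ≡ true → Valid e →
                     (∀ w → w ≢ v → HerderWins k (graph (remove σ e)) w) →
                     HerderWins (suc k) (graph σ) v
    herderWins-cut {e = e} present valid next = cut a b (link e present ab) λ w w≢v _ →
      herderWins-cong (swap (graph-remove present ab)) (next w w≢v)
      where
      a b : Fin n
      a = fromℕ< (source<n valid)
      b = fromℕ< (target<n valid)
      ab : Joins e (toℕ a) (toℕ b)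
      ab = valid , inj₁ (sym (toℕ-fromℕ< _) , sym (toℕ-fromℕ< _))

    catWins-edge : ∀ {σ t y} → Link σ t y → CatWinsAt 1 σ t
    catWins-edge l _ refl with neighbour l
    ... | w , _ , vw = step (w , vw) λ _ _ _ → inj₁ refl

    record Fork (σ : EdgeSet) (w : ℕ) : Set where
      constructor fork
      field
        {x y}    : ℕ
        left     : Link σ w x
        right    : Link σ w y
        distinct : label left ≢ label right

    catWins-fork : ∀ {σ t} → Fork σ t → CatWinsAt 2 σ t
    catWins-fork {σ} (fork left right distinct) w refl = catWins-step left reply
      where
      crossSurviving : ∀ {e x y} (l : Link σ x y) → label l ≢ e →
                       Move (remove σ e) x (CatWinsAt 1 (remove σ e))
      crossSurviving l l≢e = moveAlong (keep l l≢e) (catWins-edge (flip (keep l l≢e)))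
      reply : ∀ e → σ e ≡ true → Valid e → Move (remove σ e) (toℕ w) (CatWinsAt 1 (remove σ e))
      reply e _ _ with label left ≟ₗ e
      ... | no left≢e = crossSurviving left left≢e
      ... | yes refl  = crossSurviving right (distinct ∘ sym)

    record Trail (σ : EdgeSet) (w : ℕ) : Set where
      constructor trail
      field
        {x x′ y y′} : ℕ
        inner₁      : Link σ w x
        outer₁      : Link σ x x′
        inner₂      : Link σ w y
        outer₂      : Link σ y y′
        distinct    : Unique (label inner₁ ∷ label outer₁ ∷ label inner₂ ∷ label outer₂ ∷ [])

    -- A cut breaks at most one of the forks x′ – x – w and w – y – y′; the cat crosses to the
    -- middle of an intact one.
    catWins-trail : ∀ {σ t} → Trail σ t → CatWinsAt 3 σ t
    catWins-trail {σ} (trail inner₁ outer₁ inner₂ outer₂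
                        ((i₁≢o₁ ∷ i₁≢i₂ ∷ i₁≢o₂ ∷ []) ∷ (o₁≢i₂ ∷ o₁≢o₂ ∷ []) ∷ (i₂≢o₂ ∷ []) ∷ _)) w refl =
      catWins-step inner₁ reply
      where
      crossSurviving : ∀ {e x y z} (inner : Link σ x y) (outer : Link σ y z) →
                       label inner ≢ e → label outer ≢ e → label inner ≢ label outer →
                       Move (remove σ e) x (CatWinsAt 2 (remove σ e))
      crossSurviving inner outer inner≢e outer≢e inner≢outer =
        moveAlong (keep inner inner≢e)
                  (catWins-fork (fork (flip (keep inner inner≢e)) (keep outer outer≢e) inner≢outer))
      reply : ∀ e → σ e ≡ true → Valid e → Move (remove σ e) (toℕ w) (CatWinsAt 2 (remove σ e))
      reply e _ _ with label inner₁ ≟ₗ e | label outer₁ ≟ₗ e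
      ... | yes refl | _        = crossSurviving inner₂ outer₂ (i₁≢i₂ ∘ sym) (i₁≢o₂ ∘ sym) i₂≢o₂
      ... | no _     | yes refl = crossSurviving inner₂ outer₂ (o₁≢i₂ ∘ sym) (o₁≢o₂ ∘ sym) i₂≢o₂
      ... | no i₁≢e  | no o₁≢e  = crossSurviving inner₁ outer₁ i₁≢e o₁≢e i₁≢o₁

-- The hub v₀ is the number 0 and the rim vertex vᵢ is the number i ∈ [1, m]; `rim j` is the rim
-- edge from j to `next j`. Labels whose index lies outside [1, m] are not Valid: they join
-- nothing and are never counted, whatever an edge set says about them.
module Wheel (m : ℕ) (3≤m : 3 ≤ m) where

  Rim : ℕ → Set
  Rim = InRange m

  Rim≢0 : ∀ {i} → Rim i → i ≢ 0
  Rim≢0 (1≤i , _) refl = <⇒≱ 1≤i z≤n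

  Rim-1 : Rim 1
  Rim-1 = s≤s z≤n , ≤-trans (s≤s z≤n) 3≤m

  Rim-m : Rim m
  Rim-m = ≤-trans (s≤s z≤n) 3≤m , ≤-refl

  1≢m : 1 ≢ m
  1≢m = <⇒≢ (≤-trans (s≤s (s≤s z≤n)) 3≤m)

  2≢m : 2 ≢ m
  2≢m = <⇒≢ 3≤m

  next : ℕ → ℕ
  next j = if does (j ≟ m) then 1 else suc j

  prev : ℕ → ℕ
  prev j = if does (j ≟ 1) then m else pred j

  next-last : next m ≡ 1
  next-last rewrite dec-true (m ≟ m) refl = refl

  next-other : ∀ {j} → j ≢ m → next j ≡ suc j
  next-other {j} j≢m rewrite dec-false (j ≟ m) j≢m = refl

  next-Rim : ∀ {j} → Rim j → Rim (next j)
  next-Rim {j} (_ , j≤m) with j ≟ m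
  ... | yes refl rewrite next-last      = Rim-1
  ... | no j≢m   rewrite next-other j≢m = s≤s z≤n , ≤∧≢⇒< j≤m j≢m

  prev-Rim : ∀ {j} → Rim j → Rim (prev j)
  prev-Rim {suc zero}    _            = Rim-m
  prev-Rim {suc (suc j)} (_ , 2+j≤m) = s≤s z≤n , <⇒≤ 2+j≤m

  next-prev : ∀ {j} → Rim j → next (prev j) ≡ j
  next-prev {suc zero}    _            = next-last
  next-prev {suc (suc j)} (_ , 2+j≤m) = next-other (<⇒≢ 2+j≤m)

  prev-next : ∀ {j} → Rim j → prev (next j) ≡ j
  prev-next {j} j∈ with j ≟ m
  ... | yes refl rewrite next-last      = refl
  ... | no j≢m   rewrite next-other j≢m = prev-suc j∈
    where
    prev-suc : ∀ {j} → Rim j → prev (suc j) ≡ j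
    prev-suc {suc j} _ = refl

  prev-injective : ∀ {i j} → Rim i → Rim j → prev i ≡ prev j → i ≡ j
  prev-injective i∈ j∈ eq = trans (sym (next-prev i∈)) (trans (cong next eq) (next-prev j∈))

  next-≢ : ∀ {j} → Rim j → next j ≢ j
  next-≢ {j} _ with j ≟ m
  ... | yes refl rewrite next-last      = 1≢m
  ... | no j≢m   rewrite next-other j≢m = 1+n≢n

  next²-≢ : ∀ {j} → Rim j → next (next j) ≢ j
  next²-≢ {j} j∈ with j ≟ m | suc j ≟ m
  ... | yes refl | _         rewrite next-last | next-other 1≢m = 2≢m
  ... | no j≢m   | yes 1+j≡m rewrite next-other j≢m | 1+j≡m | next-last =
    λ 1≡j → 2≢m (trans (cong suc 1≡j) 1+j≡m)
  ... | no j≢m   | no 1+j≢m  rewrite next-other j≢m | next-other 1+j≢m =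
    <⇒≢ (m<n⇒m<1+n (n<1+n j)) ∘ sym

  prev-≢ : ∀ {j} → Rim j → prev j ≢ j
  prev-≢ j∈ prev≡j = next-≢ j∈ (trans (cong next (sym prev≡j)) (next-prev j∈))

  prev²-≢ : ∀ {j} → Rim j → prev (prev j) ≢ j
  prev²-≢ {j} j∈ prev²≡j = next²-≢ j∈ (begin
    next (next j)                ≡⟨ cong (next ∘ next) (sym prev²≡j) ⟩
    next (next (prev (prev j)))  ≡⟨ cong next (next-prev (prev-Rim j∈)) ⟩
    next (prev j)                ≡⟨ next-prev j∈ ⟩
    j                            ∎)
    where open ≡-Reasoning

  prev≢next : ∀ {j} → Rim j → prev j ≢ next j
  prev≢next j∈ prev≡next = next²-≢ (prev-Rim j∈) (trans (cong next (next-prev j∈)) (sym prev≡next))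

  Edge : Set
  Edge = ℕ ⊎ ℕ

  pattern spoke i = inj₁ i
  pattern rim   j = inj₂ j

  Valid : Edge → Set
  Valid (spoke i) = Rim i
  Valid (rim j)   = Rim j

  source target : Edge → ℕ
  source (spoke i) = 0
  source (rim j)   = j
  target (spoke i) = i
  target (rim j)   = next j

  _≟ₑ_ : DecidableEquality Edge
  _≟ₑ_ = ≡-dec _≟_ _≟_

  open EdgeLabelled _≟ₑ_ Valid source target public

  rimJoins-Rim : ∀ {j x y} → Joins (rim j) x y → Rim x × Rim y
  rimJoins-Rim (j∈ , inj₁ (refl , refl)) = j∈ , next-Rim j∈
  rimJoins-Rim (j∈ , inj₂ (refl , refl)) = next-Rim j∈ , j∈

  simple : ∀ {e f x y} → Joins e x y → Joins f x y → e ≡ f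
  simple {spoke i} {spoke _} (_  , inj₁ (refl , refl)) (_ , inj₁ (_ , refl)) = refl
  simple {spoke i} {spoke _} (_  , inj₂ (refl , refl)) (_ , inj₂ (_ , refl)) = refl
  simple {spoke i} {spoke _} (i∈ , inj₁ (refl , refl)) (_ , inj₂ (0≡i , _)) =
    ⊥-elim (Rim≢0 i∈ (sym 0≡i))
  simple {spoke i} {spoke _} (i∈ , inj₂ (refl , refl)) (_ , inj₁ (0≡i , _)) =
    ⊥-elim (Rim≢0 i∈ (sym 0≡i))
  simple {spoke i} {rim j} (_ , inj₁ (refl , _)) xy = ⊥-elim (Rim≢0 (proj₁ (rimJoins-Rim xy)) refl)
  simple {spoke i} {rim j} (_ , inj₂ (refl , _)) xy = ⊥-elim (Rim≢0 (proj₂ (rimJoins-Rim xy)) refl)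
  simple {rim j} {spoke i} xy (_ , inj₁ (refl , _)) = ⊥-elim (Rim≢0 (proj₁ (rimJoins-Rim xy)) refl)
  simple {rim j} {spoke i} xy (_ , inj₂ (refl , _)) = ⊥-elim (Rim≢0 (proj₂ (rimJoins-Rim xy)) refl)
  simple {rim j} {rim _} (_  , inj₁ (refl , refl)) (_ , inj₁ (refl , _)) = refl
  simple {rim j} {rim _} (_  , inj₂ (refl , refl)) (_ , inj₂ (refl , _)) = refl
  simple {rim j} {rim _} (j∈ , inj₁ (refl , refl)) (_ , inj₂ (j′≡y , next-j′≡x)) =
    ⊥-elim (next²-≢ j∈ (trans (cong next (sym j′≡y)) next-j′≡x))
  simple {rim j} {rim _} (j∈ , inj₂ (refl , refl)) (_ , inj₁ (j′≡x , next-j′≡y)) =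
    ⊥-elim (next²-≢ j∈ (trans (cong next (sym j′≡x)) next-j′≡y))

  loopless : ∀ {e} → Valid e → source e ≢ target e
  loopless {spoke i} i∈ = Rim≢0 i∈ ∘ sym
  loopless {rim j}   j∈ = next-≢ j∈ ∘ sym

  source<n : ∀ {e} → Valid e → source e < suc m
  source<n {spoke i} _         = s≤s z≤n
  source<n {rim j}   (_ , j≤m) = s≤s j≤m

  target<n : ∀ {e} → Valid e → target e < suc m
  target<n {spoke i} (_ , i≤m) = s≤s i≤m
  target<n {rim j}   j∈        = s≤s (proj₂ (next-Rim j∈))

  open Game (suc m) loopless source<n target<n simple public

  hub : Fin (suc m)
  hub = Data.Fin.zero

  toℕ-Rim : (v : Fin (suc m)) → toℕ v ≢ 0 → Rim (toℕ v)
  toℕ-Rim v v≢0 = n≢0⇒n>0 v≢0 , s≤s⁻¹ (toℕ<n v)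

  full : EdgeSet
  full _ = true

  wheel⇔full : WheelAdj (suc m) ⇔ graph full
  wheel⇔full = to , from
    where
    to : ∀ {x y} → WheelAdj (suc m) x y → graph full x y
    to {x} {y} (inj₁ (x≡0 , y≢0)) =
      link (spoke (toℕ y)) refl (toℕ-Rim y y≢0 , inj₁ (sym x≡0 , refl))
    to {x} {y} (inj₂ (inj₁ (y≡0 , x≢0))) =
      link (spoke (toℕ x)) refl (toℕ-Rim x x≢0 , inj₂ (sym y≡0 , refl))
    to {x} {y} (inj₂ (inj₂ (inj₁ (x≢0 , y≡1+x)))) =
      link (rim (toℕ x)) refl (toℕ-Rim x x≢0 , inj₁ (refl , trans (next-other x≢m) (sym y≡1+x)))
      where
      x≢m : toℕ x ≢ m
      x≢m x≡m = <⇒≱ (toℕ<n y) (≤-reflexive (trans (cong suc (sym x≡m)) (sym y≡1+x)))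
    to {x} {y} (inj₂ (inj₂ (inj₂ (inj₁ (y≢0 , x≡1+y))))) =
      link (rim (toℕ y)) refl (toℕ-Rim y y≢0 , inj₂ (refl , trans (next-other y≢m) (sym x≡1+y)))
      where
      y≢m : toℕ y ≢ m
      y≢m y≡m = <⇒≱ (toℕ<n x) (≤-reflexive (trans (cong suc (sym y≡m)) (sym x≡1+y)))
    to (inj₂ (inj₂ (inj₂ (inj₂ (inj₁ (x≡1 , y≡m)))))) =
      link (rim m) refl (Rim-m , inj₂ (sym y≡m , trans next-last (sym x≡1)))
    to (inj₂ (inj₂ (inj₂ (inj₂ (inj₂ (y≡1 , x≡m)))))) =
      link (rim m) refl (Rim-m , inj₁ (sym x≡m , trans next-last (sym y≡1)))
    from : ∀ {x y} → graph full x y → WheelAdj (suc m) x y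
    from (link (spoke i) _ (i∈ , inj₁ (0≡x , i≡y))) = inj₁ (sym 0≡x , Rim≢0 i∈ ∘ trans i≡y)
    from (link (spoke i) _ (i∈ , inj₂ (0≡y , i≡x))) = inj₂ (inj₁ (sym 0≡y , Rim≢0 i∈ ∘ trans i≡x))
    from (link (rim j) _ (j∈ , inj₁ (refl , next-j≡y))) with j ≟ m
    ... | yes j≡m =
      inj₂ (inj₂ (inj₂ (inj₂ (inj₂ (trans (sym next-j≡y) (trans (cong next j≡m) next-last) , j≡m)))))
    ... | no j≢m  = inj₂ (inj₂ (inj₁ (Rim≢0 j∈ , trans (sym next-j≡y) (next-other j≢m))))
    from (link (rim j) _ (j∈ , inj₂ (refl , next-j≡x))) with j ≟ m
    ... | yes j≡m =
      inj₂ (inj₂ (inj₂ (inj₂ (inj₁ (trans (sym next-j≡x) (trans (cong next j≡m) next-last) , j≡m)))))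
    ... | no j≢m  = inj₂ (inj₂ (inj₂ (inj₁ (Rim≢0 j∈ , trans (sym next-j≡x) (next-other j≢m)))))

  spokes rims size : EdgeSet → ℕ
  spokes σ = count (λ i → σ (spoke i)) m
  rims   σ = count (λ j → σ (rim j)) m
  size   σ = spokes σ + rims σ

  count-removed : ∀ {σ} (kind : ℕ → Edge) → (∀ {i j} → kind i ≡ kind j → i ≡ j) →
                  ∀ {j} → Rim j → σ (kind j) ≡ true →
                  count (σ ∘ kind) m ≡ suc (count (remove σ (kind j) ∘ kind) m)
  count-removed {σ} kind injective j∈ present =
    count-remove m j∈ (λ i i≢j → sym (remove-kept {σ} (i≢j ∘ injective))) present (remove-removed σ _)

  count-unaffected : ∀ {σ e} (kind : ℕ → Edge) → (∀ i → kind i ≢ e) →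
                     count (σ ∘ kind) m ≡ count (remove σ e ∘ kind) m
  count-unaffected {σ} kind kind≢e = sumTo-cong m λ i _ → cong bit (sym (remove-kept {σ} (kind≢e i)))

  size-remove : ∀ {σ e} → σ e ≡ true → Valid e → size σ ≡ suc (size (remove σ e))
  size-remove {σ} {spoke i} present i∈ =
    cong₂ _+_ (count-removed {σ} spoke inj₁-injective i∈ present)
              (count-unaffected {σ} {spoke i} rim λ _ ())
  size-remove {σ} {rim j}   present j∈ =
    trans (cong₂ _+_ (count-unaffected {σ} {rim j} spoke λ _ ())
                     (count-removed {σ} rim inj₂-injective j∈ present))
          (+-suc _ _)

  size-full : size full ≡ m + m
  size-full = cong₂ _+_ (count-all m λ _ _ → refl) (count-all m λ _ _ → refl)

  -- The herder's strategy

  NoRims AllSpokes : EdgeSet → Set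
  NoRims    σ = ∀ j → Rim j → σ (rim j) ≡ false
  AllSpokes σ = ∀ i → Rim i → σ (spoke i) ≡ true

  herderWins-rimVertex : ∀ {σ} {w : Fin (suc m)} → NoRims σ → toℕ w ≢ 0 → HerderWins 1 (graph σ) w
  herderWins-rimVertex {σ} {w} noRims w≢0 = herderWins-pendant onlyHub hub?
    where
    noRim : ∀ {j} → Rim j → σ (rim j) ≢ true
    noRim {j} j∈ present with () ← trans (sym (noRims j j∈)) present
    onlyHub : ∀ {y} → graph σ w y → y ≡ hub
    onlyHub (link (spoke _) _ (_ , inj₁ (0≡w , _))) = ⊥-elim (w≢0 (sym 0≡w))
    onlyHub (link (spoke _) _ (_ , inj₂ (0≡y , _))) = toℕ-injective (sym 0≡y)
    onlyHub (link (rim _) present (j∈ , _))         = ⊥-elim (noRim j∈ present)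
    hub? : Dec (graph σ w hub)
    hub? with σ (spoke (toℕ w)) in spoke-w
    ... | true  = yes (link (spoke (toℕ w)) spoke-w (toℕ-Rim w w≢0 , inj₂ (refl , refl)))
    ... | false = no absent
      where
      absent : ¬ graph σ w hub
      absent (link (spoke _) _ (_ , inj₁ (0≡w , _)))       = w≢0 (sym 0≡w)
      absent (link (spoke _) present (_ , inj₂ (_ , refl))) with () ← trans (sym spoke-w) present
      absent (link (rim _) present (j∈ , _))               = noRim j∈ present

  herderWins-rimless : ∀ {σ} → NoRims σ → AllSpokes σ → ∀ v → HerderWins 2 (graph σ) v
  herderWins-rimless {σ} noRims allSpokes v with toℕ v ≟ 0
  ... | no v≢0  = herderWins-suc (herderWins-rimVertex noRims v≢0)
  ... | yes v≡0 = herderWins-cut (allSpokes 1 Rim-1) Rim-1 λ w w≢v →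
    herderWins-rimVertex (λ j j∈ → trans (remove-kept {σ} {spoke 1} {rim j} λ ()) (noRims j j∈))
                         (λ w≡0 → w≢v (toℕ-injective (trans w≡0 (sym v≡0))))

  herderWins-cuttingRims : ∀ t {σ} → AllSpokes σ → rims σ ≡ t → ∀ v → HerderWins (2 + t) (graph σ) v
  herderWins-cuttingRims t {σ} allSpokes rims≡t v with search (λ j → σ (rim j) ≟ᵇ true) m
  ... | no none =
    subst (λ t → HerderWins (2 + t) (graph σ) v) (trans (sym (count-none m noRims)) rims≡t)
          (herderWins-rimless noRims allSpokes v)
    where
    noRims : NoRims σ
    noRims j j∈ = ¬-not λ present → none (j , j∈ , present)
  herderWins-cuttingRims zero {σ} allSpokes rims≡0 v | yes (j , j∈ , present) =
    ⊥-elim (0≢1+n (trans (sym rims≡0) (count-removed {σ} rim inj₂-injective j∈ present)))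
  herderWins-cuttingRims (suc t) {σ} allSpokes rims≡1+t v | yes (j , j∈ , present) =
    herderWins-cut present j∈ λ w _ →
      herderWins-cuttingRims t (λ i i∈ → trans (remove-kept {σ} {rim j} {spoke i} λ ()) (allSpokes i i∈))
                             (suc-injective (trans (sym (count-removed {σ} rim inj₂-injective j∈ present))
                                                   rims≡1+t))
                             w

  herderWins-wheel : ∀ v → HerderWins (2 + m) (WheelAdj (suc m)) v
  herderWins-wheel v =
    herderWins-cong (swap wheel⇔full) (herderWins-cuttingRims m (λ _ _ → refl) (count-all m λ _ _ → refl) v)

  -- Spoked vertices and rim arcs

  Spoke : EdgeSet → ℕ → Set
  Spoke σ i = Rim i × σ (spoke i) ≡ true

  spokeLink : ∀ {σ i} → Spoke σ i → Link σ 0 i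
  spokeLink (i∈ , present) = link (spoke _) present (i∈ , inj₁ (refl , refl))

  viaHub : ∀ {σ i t} → Star (Link σ) i 0 → Spoke σ t → Star (Link σ) i t
  viaHub toHub spoke-t = toHub ◅◅ spokeLink spoke-t ◅ ε

  record RimLink (σ : EdgeSet) (x y : ℕ) : Set where
    constructor rimLink
    field
      index   : ℕ
      present : σ (rim index) ≡ true
      joins   : Joins (rim index) x y

  open RimLink using (index)

  asLink : ∀ {σ x y} → RimLink σ x y → Link σ x y
  asLink (rimLink j present joins) = link (rim j) present joins

  flipRim : ∀ {σ x y} → RimLink σ x y → RimLink σ y x
  flipRim (rimLink j present joins) = rimLink j present (joins-sym {rim j} joins)

  rimLink-next : ∀ {σ j} → Rim j → σ (rim j) ≡ true → RimLink σ j (next j)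
  rimLink-next j∈ present = rimLink _ present (j∈ , inj₁ (refl , refl))

  rimLink-prev : ∀ {σ j} → Rim j → σ (rim (prev j)) ≡ true → RimLink σ j (prev j)
  rimLink-prev j∈ present = rimLink _ present (prev-Rim j∈ , inj₂ (refl , next-prev j∈))

  RimWalk : EdgeSet → ℕ → ℕ → Set
  RimWalk σ = Star (RimLink σ)

  rimWalk-reverse : ∀ {σ x y} → RimWalk σ x y → RimWalk σ y x
  rimWalk-reverse = Star.reverse flipRim

  record SharedArc (σ : EdgeSet) : Set where
    constructor sharedArc
    field
      {a b}    : ℕ
      distinct : a ≢ b
      spoke-a  : Spoke σ a
      spoke-b  : Spoke σ b
      walk     : RimWalk σ a b

  Anchored : EdgeSet → ℕ → Set
  Anchored σ i = Spoke σ i × ∃ λ b → b ≢ i × Spoke σ b × RimWalk σ i b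

  sharedArc⇒anchored : ∀ {σ} → SharedArc σ → ∀ i → ∃ λ t → t ≢ i × Anchored σ t
  sharedArc⇒anchored {σ} (sharedArc {a} {b} a≢b spoke-a spoke-b walk) i with a ≟ i
  ... | no a≢i   = a , a≢i , spoke-a , b , a≢b ∘ sym , spoke-b , walk
  ... | yes refl = b , a≢b ∘ sym , spoke-b , a , a≢b , spoke-a , rimWalk-reverse {σ} walk

  anchored-reachesHub : ∀ {σ i} → Anchored σ i → ∀ e → Star (Link (remove σ e)) i 0
  anchored-reachesHub {σ} {i} (spoke-i , b , b≢i , spoke-b , walk) e with e ≟ₑ spoke i
  ... | yes refl = Star.map (λ l → keep (asLink l) λ ()) walk ◅◅
                   flip (keep (spokeLink spoke-b) (b≢i ∘ inj₁-injective)) ◅ ε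
  ... | no e≢i   = flip (keep (spokeLink spoke-i) (e≢i ∘ sym)) ◅ ε

  -- Pigeonhole on the rim arcs

  prefixSize : EdgeSet → ℕ → ℕ
  prefixSize σ t = count (λ i → σ (spoke i)) t + count (λ j → σ (rim j)) t

  prefixSize-suc : ∀ σ t → prefixSize σ (suc t) ≡
                           bit (σ (spoke (suc t))) + bit (σ (rim (suc t))) + prefixSize σ t
  prefixSize-suc σ t = interchange (bit (σ (spoke (suc t)))) _ _ _

  -- Unless two spokes share an arc, each
  -- arc closed by a missing rim edge carries at most one spoke, so prefixSize σ t ≤ t; the
  -- value t + 1 needs rim t present and a spoke on the arc still open at t.
  data Scan (σ : EdgeSet) (t : ℕ) : Set where
    found : SharedArc σ → Scan σ t
    loose : prefixSize σ t ≤ t → Scan σ t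
    tight : ∀ {c} → prefixSize σ t ≤ suc t → σ (rim t) ≡ true →
            Spoke σ c → c ≤ t → RimWalk σ c t → Scan σ t

  scan-suc : ∀ {σ t} → suc t ≤ m → Scan σ t → Scan σ (suc t)
  scan-suc {σ} {t} 1+t≤m state = extend state (σ (spoke (suc t))) refl (σ (rim (suc t))) refl
    where
    bound : ∀ {s r k} → σ (spoke (suc t)) ≡ s → σ (rim (suc t)) ≡ r →
            bit s + bit r + prefixSize σ t ≤ k → prefixSize σ (suc t) ≤ k
    bound {k = k} refl refl = subst (_≤ k) (sym (prefixSize-suc σ t))
    1+t∈ : Rim (suc t)
    1+t∈ = s≤s z≤n , 1+t≤m
    forward : ∀ {c} → Spoke σ c → c ≤ t → σ (rim t) ≡ true → RimLink σ t (suc t)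
    forward ((1≤c , _) , _) c≤t rim-t =
      rimLink t rim-t ((≤-trans 1≤c c≤t , <⇒≤ 1+t≤m) , inj₁ (refl , next-other (<⇒≢ 1+t≤m)))
    extend : Scan σ t → ∀ s → σ (spoke (suc t)) ≡ s → ∀ r → σ (rim (suc t)) ≡ r → Scan σ (suc t)
    extend (found arc)   _     _ _     _ = found arc
    extend (loose small) true  s true  r = tight (bound s r (s≤s (s≤s small))) r (1+t∈ , s) ≤-refl ε
    extend (loose small) true  s false r = loose (bound s r (s≤s small))
    extend (loose small) false s true  r = loose (bound s r (s≤s small))
    extend (loose small) false s false r = loose (bound s r (m≤n⇒m≤1+n small))
    extend (tight small rim-t spoke-c c≤t walk) true s _ _ =
      found (sharedArc (<⇒≢ (s≤s c≤t)) spoke-c (1+t∈ , s) (walk ◅◅ forward spoke-c c≤t rim-t ◅ ε))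
    extend (tight small rim-t spoke-c c≤t walk) false s true r =
      tight (bound s r (s≤s small)) r spoke-c (m≤n⇒m≤1+n c≤t) (walk ◅◅ forward spoke-c c≤t rim-t ◅ ε)
    extend (tight small _ _ _ _) false s false r = loose (bound s r small)

  scan : ∀ σ t → t ≤ m → Scan σ t
  scan σ zero    _     = loose z≤n
  scan σ (suc t) 1+t≤m = scan-suc 1+t≤m (scan σ t (<⇒≤ 1+t≤m))

  2+m≤size⇒sharedArc : ∀ {σ} → 2 + m ≤ size σ → SharedArc σ
  2+m≤size⇒sharedArc {σ} big with scan σ m ≤-refl
  ... | found arc           = arc
  ... | loose small         = ⊥-elim (<⇒≱ big (m≤n⇒m≤1+n small))
  ... | tight small _ _ _ _ = ⊥-elim (<⇒≱ big small)

  lastRimMissing⇒sharedArc : ∀ {σ} → σ (rim m) ≡ false → 1 + m ≤ size σ → SharedArc σ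
  lastRimMissing⇒sharedArc {σ} absent big with scan σ m ≤-refl
  ... | found arc             = arc
  ... | loose small           = ⊥-elim (<⇒≱ big small)
  ... | tight _ present _ _ _ with () ← trans (sym absent) present

  shift : Edge → Edge
  shift (spoke i) = spoke (prev i)
  shift (rim j)   = rim (prev j)

  rotate : EdgeSet → EdgeSet
  rotate σ = σ ∘ shift

  sumTo-prev : ∀ f → sumTo (f ∘ prev) m ≡ sumTo f m
  sumTo-prev f = trans (shifted m (proj₁ Rim-m)) (sym (lastTerm (proj₁ Rim-m)))
    where
    lastTerm : ∀ {k} → 1 ≤ k → sumTo f k ≡ f k + sumTo f (pred k)
    lastTerm {suc k} _ = refl
    shifted : ∀ k → 1 ≤ k → sumTo (f ∘ prev) k ≡ f m + sumTo f (pred k)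
    shifted (suc zero)    _ = refl
    shifted (suc (suc k)) _ =
      trans (cong (f (suc k) +_) (shifted (suc k) (s≤s z≤n))) (x∙yz≈y∙xz (f (suc k)) (f m) _)

  size-rotate : ∀ σ → size (rotate σ) ≡ size σ
  size-rotate σ = cong₂ _+_ (sumTo-prev (λ i → bit (σ (spoke i)))) (sumTo-prev (λ j → bit (σ (rim j))))

  sharedArc-rotate : ∀ {σ} → SharedArc (rotate σ) → SharedArc σ
  sharedArc-rotate {σ} (sharedArc a≢b (a∈ , spoke-a) (b∈ , spoke-b) walk) =
    sharedArc (a≢b ∘ prev-injective a∈ b∈) (prev-Rim a∈ , spoke-a) (prev-Rim b∈ , spoke-b)
              (Star.gmap prev unrotate walk)
    where
    next∘prev≡prev∘next : ∀ {j} → Rim j → next (prev j) ≡ prev (next j)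
    next∘prev≡prev∘next j∈ = trans (next-prev j∈) (sym (prev-next j∈))
    unrotate : ∀ {x y} → RimLink (rotate σ) x y → RimLink σ (prev x) (prev y)
    unrotate (rimLink j present (j∈ , inj₁ (refl , refl))) =
      rimLink (prev j) present (prev-Rim j∈ , inj₁ (refl , next∘prev≡prev∘next j∈))
    unrotate (rimLink j present (j∈ , inj₂ (refl , refl))) =
      rimLink (prev j) present (prev-Rim j∈ , inj₂ (refl , next∘prev≡prev∘next j∈))

  rimMissing⇒sharedArc : ∀ {σ j} → Rim j → σ (rim j) ≡ false → 1 + m ≤ size σ → SharedArc σ
  rimMissing⇒sharedArc {j = j} (1≤j , j≤m) = rotating (m ∸ j) (m+[n∸m]≡n j≤m) 1≤j
    where
    rotating : ∀ d {σ j} → j + d ≡ m → 1 ≤ j → σ (rim j) ≡ false → 1 + m ≤ size σ → SharedArc σ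
    rotating zero {σ} {j} j+0≡m _ absent big =
      lastRimMissing⇒sharedArc (subst (λ k → σ (rim k) ≡ false) (trans (sym (+-identityʳ j)) j+0≡m) absent)
                               big
    rotating (suc d) {σ} {suc j} j+1+d≡m _ absent big =
      sharedArc-rotate (rotating d {rotate σ} (trans (sym (+-suc (suc j) d)) j+1+d≡m) (s≤s z≤n) absent
                                 (subst (1 + m ≤_) (sym (size-rotate σ)) big))

  -- Trails of four edges

  hubTrail : ∀ {σ a b x y} → a ≢ b → Spoke σ a → Spoke σ b →
             (la : RimLink σ a x) (lb : RimLink σ b y) → index la ≢ index lb → Trail σ 0
  hubTrail a≢b spoke-a spoke-b la lb ja≢jb =
    trail (spokeLink spoke-a) (asLink la) (spokeLink spoke-b) (asLink lb)
          (((λ ()) ∷ (a≢b ∘ inj₁-injective) ∷ (λ ()) ∷ []) ∷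
           ((λ ()) ∷ (ja≢jb ∘ inj₂-injective) ∷ []) ∷
           ((λ ()) ∷ []) ∷ [] ∷ [])

  triangleTrail : ∀ {σ a b c} → Spoke σ a → Spoke σ b → Spoke σ c → c ≢ a → c ≢ b →
                  RimLink σ a b → Trail σ a
  triangleTrail {a = a} spoke-a spoke-b spoke-c c≢a c≢b ab@(rimLink j _ joins) =
    trail (flip (spokeLink spoke-a)) (spokeLink spoke-c) (asLink ab) (flip (spokeLink spoke-b))
          (((c≢a ∘ sym ∘ inj₁-injective) ∷ (λ ()) ∷ (a≢b ∘ inj₁-injective) ∷ []) ∷
           ((λ ()) ∷ (c≢b ∘ inj₁-injective) ∷ []) ∷
           ((λ ()) ∷ []) ∷ [] ∷ [])
    where
    a≢b : a ≢ _
    a≢b refl = joins-irrefl {rim j} joins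

  rimTrail : ∀ {σ p w y y′} → Spoke σ p →
             (l₁ : RimLink σ w p) (l₂ : RimLink σ w y) (l₃ : RimLink σ y y′) →
             index l₁ ≢ index l₂ → index l₁ ≢ index l₃ → index l₂ ≢ index l₃ → Trail σ w
  rimTrail spoke-p l₁ l₂ l₃ j₁≢j₂ j₁≢j₃ j₂≢j₃ =
    trail (asLink l₁) (flip (spokeLink spoke-p)) (asLink l₂) (asLink l₃)
          (((λ ()) ∷ (j₁≢j₂ ∘ inj₂-injective) ∷ (j₁≢j₃ ∘ inj₂-injective) ∷ []) ∷
           ((λ ()) ∷ (λ ()) ∷ []) ∷
           ((j₂≢j₃ ∘ inj₂-injective) ∷ []) ∷ [] ∷ [])

  AllRims : EdgeSet → Set
  AllRims σ = ∀ j → Rim j → σ (rim j) ≡ true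

  trailAfter : ∀ {σ p} → AllRims σ → Spoke σ p → Trail σ (next p)
  trailAfter allRims spoke-p@(p∈ , _) =
    rimTrail spoke-p (rimLink _ (allRims _ p∈) (p∈ , inj₂ (refl , refl)))
             (rimLink-next p′∈ (allRims _ p′∈)) (rimLink-next p″∈ (allRims _ p″∈))
             (next-≢ p∈ ∘ sym) (next²-≢ p∈ ∘ sym) (next-≢ p′∈ ∘ sym)
    where
    p′∈ = next-Rim p∈
    p″∈ = next-Rim p′∈

  trailBefore : ∀ {σ p} → AllRims σ → Spoke σ p → Trail σ (prev p)
  trailBefore allRims spoke-p@(p∈ , _) =
    rimTrail spoke-p (rimLink _ (allRims _ p′∈) (p′∈ , inj₁ (refl , next-prev p∈)))
             (rimLink-prev p′∈ (allRims _ p″∈)) (rimLink-prev p″∈ (allRims _ (prev-Rim p″∈)))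
             (prev-≢ p′∈ ∘ sym) (prev²-≢ p∈ ∘ sym ∘ prev-injective p∈ p″∈) (prev-≢ p″∈ ∘ sym)
    where
    p′∈ = prev-Rim p∈
    p″∈ = prev-Rim p′∈

  trailOnFullRim : ∀ {σ i} → 1 + m ≤ size σ → AllRims σ → Star (Link σ) i 0 → Move σ i (Trail σ)
  trailOnFullRim {σ} {i} big allRims toHub with search (λ p → σ (spoke p) ≟ᵇ true) m
  ... | no none = ⊥-elim (<⇒≱ big (≤-trans (≤-reflexive (cong (_+ rims σ) spokes≡0)) (count-≤ _ m)))
    where
    spokes≡0 : spokes σ ≡ 0
    spokes≡0 = count-none m λ p p∈ → ¬-not λ present → none (p , p∈ , present)
  ... | yes (p , p∈ , present) with next p ≟ i
  ...   | no next≢i = next p , next≢i ,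
                      viaHub toHub (p∈ , present) ◅◅ asLink (rimLink-next p∈ (allRims _ p∈)) ◅ ε ,
                      trailAfter allRims (p∈ , present)
  ...   | yes refl  = prev p , prev≢next p∈ ,
                      viaHub toHub (p∈ , present) ◅◅ asLink (rimLink-prev p∈ (allRims _ (prev-Rim p∈))) ◅ ε ,
                      trailBefore allRims (p∈ , present)

  trailAtRimEdge : ∀ {σ i j} → 1 + m ≤ size σ → Rim i → Star (Link σ) i 0 →
                   Rim j → σ (rim j) ≡ true → Spoke σ j → Spoke σ (next j) → Move σ i (Trail σ)
  trailAtRimEdge {σ} {i} {j} big i∈ toHub j∈ rim-j spoke-j spoke-j′
    with search (λ c → (σ (spoke c) ≟ᵇ true ×-dec ¬? (c ≟ j)) ×-dec ¬? (c ≟ next j)) m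
  ... | yes (c , c∈ , (present , c≢j) , c≢j′) with j ≟ i
  ...   | no j≢i   = j , j≢i , viaHub toHub spoke-j ,
                     triangleTrail spoke-j spoke-j′ (c∈ , present) c≢j c≢j′ (rimLink-next j∈ rim-j)
  ...   | yes refl = next j , next-≢ j∈ , viaHub toHub spoke-j′ ,
                     triangleTrail spoke-j′ spoke-j (c∈ , present) c≢j′ c≢j (flipRim (rimLink-next j∈ rim-j))
  trailAtRimEdge {σ} {i} {j} big i∈ toHub j∈ rim-j spoke-j spoke-j′ | no none
    with σ (rim (next j)) in rim-j′ | σ (rim (prev j)) in rim-j⁻
  ... | true  | _    = 0 , Rim≢0 i∈ ∘ sym , toHub ,
                       hubTrail (next-≢ j∈ ∘ sym) spoke-j spoke-j′ (rimLink-next j∈ rim-j)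
                                (rimLink-next (next-Rim j∈) rim-j′) (next-≢ j∈ ∘ sym)
  ... | false | true = 0 , Rim≢0 i∈ ∘ sym , toHub ,
                       hubTrail (next-≢ j∈ ∘ sym) spoke-j spoke-j′ (rimLink-prev j∈ rim-j⁻)
                                (flipRim (rimLink-next j∈ rim-j)) (prev-≢ j∈)
  ... | false | false = ⊥-elim (<⇒≱ big (≤-trans (+-monoˡ-≤ (rims σ) spokes≤2) rims+2≤m))
    where
    onlyTwo : ∀ c → Rim c → σ (spoke c) ≡ true → c ≡ j ⊎ c ≡ next j
    onlyTwo c c∈ present with c ≟ j | c ≟ next j
    ... | yes c≡j | _        = inj₁ c≡j
    ... | no _    | yes c≡j′ = inj₂ c≡j′
    ... | no c≢j  | no c≢j′  = ⊥-elim (none (c , c∈ , (present , c≢j) , c≢j′))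
    spokes≤2 : spokes σ ≤ 2
    spokes≤2 = count-≤2 m j∈ (next-Rim j∈) onlyTwo
    rims+2≤m : 2 + rims σ ≤ m
    rims+2≤m = count-+2 m (next-Rim j∈) (prev-Rim j∈) (prev≢next j∈ ∘ sym) rim-j′ rim-j⁻

  adjacentOrHubTrail : ∀ {σ a b} → a ≢ b → Spoke σ a → Spoke σ b → RimWalk σ a b →
                       RimLink σ a b ⊎ Trail σ 0
  adjacentOrHubTrail {σ} {a} {b} a≢b spoke-a spoke-b walk
    with firstLink walk a≢b | firstLink (rimWalk-reverse walk) (a≢b ∘ sym)
    where
    firstLink : ∀ {x y} → RimWalk σ x y → x ≢ y → ∃ λ z → RimLink σ x z
    firstLink ε       x≢x = ⊥-elim (x≢x refl)
    firstLink (l ◅ _) _   = _ , l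
  ... | _ , la@(rimLink ja _ a-x) | _ , lb@(rimLink jb _ b-y) with ja ≟ jb
  ...   | no ja≢jb = inj₂ (hubTrail a≢b spoke-a spoke-b la lb ja≢jb)
  ...   | yes refl with joins-ends {rim ja} a-x b-y
  ...     | inj₁ (a≡b , _) = ⊥-elim (a≢b a≡b)
  ...     | inj₂ (_ , x≡b) = inj₁ (subst (RimLink σ a) x≡b la)

  trailNearby : ∀ {σ i} → 1 + m ≤ size σ → Rim i → Star (Link σ) i 0 → Move σ i (Trail σ)
  trailNearby {σ} big i∈ toHub with search (λ j → σ (rim j) ≟ᵇ false) m
  ... | no none = trailOnFullRim big (λ j j∈ → ¬-not λ absent → none (j , j∈ , absent)) toHub
  ... | yes (j , j∈ , absent) with rimMissing⇒sharedArc j∈ absent big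
  ...   | sharedArc a≢b spoke-a spoke-b walk with adjacentOrHubTrail a≢b spoke-a spoke-b walk
  ...     | inj₂ trailAtHub = 0 , Rim≢0 i∈ ∘ sym , toHub , trailAtHub
  ...     | inj₁ (rimLink _ present (j′∈ , inj₁ (refl , refl))) =
    trailAtRimEdge big i∈ toHub j′∈ present spoke-a spoke-b
  ...     | inj₁ (rimLink _ present (j′∈ , inj₂ (refl , refl))) =
    trailAtRimEdge big i∈ toHub j′∈ present spoke-b spoke-a

  -- The cat's strategy

  anchoredNearby : ∀ {σ i} → 2 + m ≤ size σ → Star (Link σ) i 0 → Move σ i (Anchored σ)
  anchoredNearby {i = i} big toHub with sharedArc⇒anchored (2+m≤size⇒sharedArc big) i
  ... | t , t≢i , anchored = t , t≢i , viaHub toHub (proj₁ anchored) , anchored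

  catWins-anchored : ∀ {k σ t} → 4 ≤ k → k + m ≤ 2 + size σ → Anchored σ t → CatWinsAt k σ t
  catWins-anchored {suc k} {σ} (s≤s 3≤k) bound anchored@(spoke-t , _) w refl =
    catWins-step (flip (spokeLink spoke-t)) λ e present valid →
      onward 3≤k (s≤s⁻¹ (subst (λ s → suc k + m ≤ 2 + s) (size-remove {σ} present valid) bound))
             (anchored-reachesHub anchored e)
    where
    onward : ∀ {k σ′} → 3 ≤ k → k + m ≤ 2 + size σ′ → Star (Link σ′) (toℕ w) 0 →
             Move σ′ (toℕ w) (CatWinsAt k σ′)
    onward (s≤s (s≤s (s≤s (z≤n {zero})))) bound′ toHub =
      Move-map catWins-trail (trailNearby (s≤s⁻¹ (s≤s⁻¹ bound′)) (proj₁ spoke-t) toHub)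
    onward (s≤s (s≤s (s≤s (z≤n {suc k})))) bound′ toHub =
      Move-map (catWins-anchored (s≤s (s≤s (s≤s (s≤s z≤n)))) bound′)
               (anchoredNearby (≤-trans (s≤s (s≤s (m≤n+m m k))) (s≤s⁻¹ (s≤s⁻¹ bound′))) toHub)

  anchored-full : ∀ {i} → Rim i → Anchored full i
  anchored-full i∈ = (i∈ , refl) , _ , next-≢ i∈ , (next-Rim i∈ , refl) , rimLink-next i∈ refl ◅ ε

  catWins-full : ∀ v → CatWins (2 + m) (graph full) v
  catWins-full v@(Data.Fin.suc _) =
    catWins-anchored (s≤s (s≤s (≤-trans (n≤1+n 2) 3≤m))) (≤-reflexive (cong (2 +_) (sym size-full)))
                     (anchored-full (toℕ-Rim v λ ())) v refl
  catWins-full Data.Fin.zero = catWins-step (spokeLink (Rim-1 , refl)) reply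
    where
    reply : ∀ e → full e ≡ true → Valid e → Move (remove full e) 0 (CatWinsAt (1 + m) (remove full e))
    reply e present valid =
      Move-map (catWins-anchored (s≤s 3≤m) (≤-reflexive (cong suc 2m≡1+size))) (anchoredNearby big ε)
      where
      2m≡1+size : m + m ≡ suc (size (remove full e))
      2m≡1+size = trans (sym size-full) (size-remove {full} present valid)
      big : 2 + m ≤ size (remove full e)
      big = s≤s⁻¹ (subst (3 + m ≤_) 2m≡1+size (+-monoˡ-≤ m 3≤m))

  catWins-wheel : ∀ v → CatWins (2 + m) (WheelAdj (suc m)) v
  catWins-wheel v = catWins-cong (swap wheel⇔full) (catWins-full v)

mainTheorem5 : (n : ℕ) → 4 ≤ n → CatNumber (WheelAdj n) (suc n)
mainTheorem5 (suc m) (s≤s 3≤m) = (hub , value hub) , λ v → 2 + m , value v , ≤-refl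
  where
  open Wheel m 3≤m
  value : ∀ v → CatAt (WheelAdj (suc m)) v (2 + m)
  value v = herderWins-wheel v , catWins-wheel v
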